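{- Let $\pi$ be any vincular cyclic pattern of length $3$ containing exactly one vinculum (i.e., $[\pi]$ is one of $[\overline{12}3],[\overline{21}3],[\overline{23}1],[\overline{32}1],[\overline{13}2],[\overline{31}2]$). Then $\left|\mathrm{Av}_n[\pi]\right|=1$ for all $n\ge 1$.
   Context: For $\sigma=\sigma_1\cdots\sigma_n\in S_n$, the cyclic permutation $[\sigma]$ is the set of all rotations $\sigma_k\cdots\sigma_n\sigma_1\cdots\sigma_{k-1}$ ($k\in[n]$) of $\sigma$; $[S_n]$ denotes the set of cyclic permutations of length $n$. A vincular pattern is a permutation $\pi$ in which some pairs of adjacent entries are overlined (each overlined adjacent pair is a vinculum). A cyclic permutation $[\sigma]$ contains the vincular cyclic pattern $[\pi]$ if some rotation of $\sigma$ has a subsequence order-isomorphic to $\pi$ in which any two entries of $\pi$ joined by a vinculum occupy adjacent positions in that rotation; otherwise $[\sigma]$ avoids $[\pi]$. $\mathrm{Av}_n[\pi]$ is the set of $[\sigma]\in[S_n]$ avoiding $[\pi]$. A cyclic pattern $[\pi]$ is the class of $\pi$ under rotation (with vincula carried along), so e.g. $[1\overline{23}]=[\overline{23}1]$. -}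

module Defs where

open import Data.Nat using (ℕ; zero; suc; _+_; _<_)
open import Data.Nat.DivMod using (_%_; m%n<n)
open import Data.Fin using (Fin; toℕ; fromℕ<; inject₁) renaming (suc to fsuc; zero to fzero)
open import Data.Product using (Σ; ∃; _×_; _,_)
open import Function.Definitions using (Injective)
open import Relation.Binary.PropositionalEquality using (_≡_)
open import Relation.Nullary using (¬_)

Perm : ℕ → Set
Perm n = Σ (Fin n → Fin n) (Injective _≡_ _≡_)

-- The k-th rotation σ_{k+1} ⋯ σ_n σ_1 ⋯ σ_k of a word of length n
-- (positions are 0-based): (rot k σ) i = σ ((i + k) mod n).
rot : {A : Set} {n : ℕ} → Fin n → (Fin n → A) → Fin n → A
rot {n = suc m} k σ i = σ (fromℕ< (m%n<n (toℕ i + toℕ k) (suc m)))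

-- A vincular pattern of length 3 with exactly one vinculum:
-- a permutation π ∈ S₃ together with v : Fin 2, meaning that the
-- entries at positions v and v+1 of π are joined by the vinculum.
record VPat3 : Set where
  constructor vpat
  field
    π  : Perm 3
    v  : Fin 2

open VPat3 public

_<ᶠ_ : {n : ℕ} → Fin n → Fin n → Set
a <ᶠ b = toℕ a < toℕ b

Occurs : {n : ℕ} → VPat3 → (Fin n → Fin n) → Set
Occurs {n} (vpat (π , _) v) τ =
  Σ (Fin 3 → Fin n) λ pos →
      (pos fzero <ᶠ pos (fsuc fzero))
    × (pos (fsuc fzero) <ᶠ pos (fsuc (fsuc fzero)))
    × (∀ a b → (π a <ᶠ π b → τ (pos a) <ᶠ τ (pos b))
             × (τ (pos a) <ᶠ τ (pos b) → π a <ᶠ π b))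
    × (suc (toℕ (pos (inject₁ v))) ≡ toℕ (pos (fsuc v)))

CycContains : {n : ℕ} → Perm n → VPat3 → Set
CycContains {n} (σ , _) p = ∃ λ (k : Fin n) → Occurs p (rot k σ)

CycAvoids : {n : ℕ} → Perm n → VPat3 → Set
CycAvoids σ p = ¬ CycContains σ p

SameCyc : {n : ℕ} → Perm n → Perm n → Set
SameCyc {n} (σ , _) (τ , _) = ∃ λ (k : Fin n) → ∀ i → τ i ≡ rot k σ i

-- The vinculum joins two cyclically adjacent entries, so [σ] contains [π] exactly
-- when σ has a cyclically adjacent pair of positions x, x + 1 and a third position c
-- whose values are ordered like the entries of π read from the vinculum on.
-- Complementing values pairs up the six patterns, leaving [\overline{21}3],
-- [\overline{32}1] and [\overline{13}2]; [12⋯n] avoids all three, since it descends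
-- only from n to 1 and ascends only by one.  Conversely, an avoider of
-- [\overline{21}3] (of [\overline{32}1]) read from just after its maximum (from its
-- minimum) has no descent, so it reads 1, 2, …, n.  An avoider of [\overline{13}2]
-- read from its minimum also reads 1, 2, …: once 1, …, i - 1 have been read, a next
-- value other than i would form an occurrence with the position of i.

module Submission where

open import Defs
open import Data.Nat using (ℕ; zero; suc; _+_; _∸_; _<_; _≤_; _≥_; z≤n; s≤s; s≤s⁻¹; z<s; s<s)
open import Data.Nat.Properties
open import Data.Nat.DivMod using (_%_; m%n<n; m%n%n≡m%n; %-distribˡ-+; [m+n]%n≡m%n; m<n⇒m%n≡m; m≤n⇒m%n≡m; n%n≡0)
open import Data.Fin using (Fin; toℕ; fromℕ; fromℕ<; inject₁; opposite; punchOut) renaming (suc to fsuc)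
open import Data.Fin.Patterns using (0F; 1F; 2F)
import Data.Fin.Properties as Fin
open import Data.Product using (Σ; ∃; ∃₂; _×_; _,_; proj₁; proj₂; map₂)
open import Data.Sum using (_⊎_; inj₁; inj₂)
open import Data.Empty using (⊥-elim)
open import Function using (_∘_)
open import Function.Definitions using (Injective)
open import Relation.Nullary using (¬_; yes; no)
open import Relation.Binary.Definitions using (tri<; tri≈; tri>)
open import Relation.Binary.PropositionalEquality
open import Algebra.Properties.CommutativeSemigroup +-commutativeSemigroup using (xy∙z≈xz∙y)

SameOrder : {A : Set} → (A → ℕ) → (A → ℕ) → Set
SameOrder f g = ∀ a b → (f a < f b → g a < g b) × (g a < g b → f a < f b)

module _ {A : Set} where

  SameOrder-∘ : {B : Set} {f g : B → ℕ} (h : A → B) → SameOrder f g → SameOrder (f ∘ h) (g ∘ h)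
  SameOrder-∘ h same a b = same (h a) (h b)

  SameOrder-resp : {f f′ g g′ : A → ℕ} → f ≗ f′ → g ≗ g′ → SameOrder f g → SameOrder f′ g′
  SameOrder-resp f≗ g≗ same a b =
      (λ lt → subst₂ _<_ (g≗ a) (g≗ b) (proj₁ (same a b) (subst₂ _<_ (sym (f≗ a)) (sym (f≗ b)) lt)))
    , (λ lt → subst₂ _<_ (f≗ a) (f≗ b) (proj₂ (same a b) (subst₂ _<_ (sym (g≗ a)) (sym (g≗ b)) lt)))

  SameOrder-reflects-≡ : {f g : A → ℕ} → SameOrder f g → ∀ {a b} → g a ≡ g b → f a ≡ f b
  SameOrder-reflects-≡ {f} same {a} {b} eq with <-cmp (f a) (f b)
  ... | tri< lt _ _ = ⊥-elim (<-irrefl eq (proj₁ (same a b) lt))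
  ... | tri≈ _ e _  = e
  ... | tri> _ _ gt = ⊥-elim (<-irrefl (sym eq) (proj₁ (same b a) gt))

increasing⇒SameOrder : ∀ {n} (h : Fin n → ℕ) → (∀ {i j} → toℕ i < toℕ j → h i < h j) → SameOrder toℕ h
increasing⇒SameOrder h mono a b = mono , reflect
  where
  reflect : h a < h b → toℕ a < toℕ b
  reflect hlt with <-cmp (toℕ a) (toℕ b)
  ... | tri< lt _ _ = lt
  ... | tri≈ _ e _  = ⊥-elim (<-irrefl (cong h (Fin.toℕ-injective e)) hlt)
  ... | tri> _ _ gt = ⊥-elim (<-asym hlt (mono gt))

opposite-< : ∀ {n} {i j : Fin n} → toℕ i < toℕ j → toℕ (opposite j) < toℕ (opposite i)
opposite-< {i = i} {j} lt rewrite Fin.opposite-prop i | Fin.opposite-prop j = ∸-monoʳ-< (s≤s lt) (Fin.toℕ<n j)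

opposite-<⁻ : ∀ {n} {i j : Fin n} → toℕ (opposite j) < toℕ (opposite i) → toℕ i < toℕ j
opposite-<⁻ {i = i} {j} lt =
  subst₂ (λ x y → toℕ x < toℕ y) (Fin.opposite-involutive i) (Fin.opposite-involutive j) (opposite-< lt)

SameOrder-opposite : ∀ {A : Set} {k l} {f : A → Fin k} {g : A → Fin l} →
  SameOrder (toℕ ∘ f) (toℕ ∘ g) → SameOrder (toℕ ∘ opposite ∘ f) (toℕ ∘ opposite ∘ g)
SameOrder-opposite same a b =
    (λ lt → opposite-< (proj₁ (same b a) (opposite-<⁻ lt)))
  , (λ lt → opposite-< (proj₂ (same b a) (opposite-<⁻ lt)))

injective⇒surjective : ∀ {n} {f : Fin n → Fin n} → Injective _≡_ _≡_ f → ∀ y → ∃ λ x → f x ≡ y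
injective⇒surjective {suc n} {f} f-inj y with Fin.any? (λ x → f x Fin.≟ y)
... | yes hit = hit
... | no miss with Fin.pigeonhole (n<1+n n) (λ x → punchOut {j = f x} (miss ∘ (x ,_) ∘ sym))
...   | i , j , i<j , eq =
  ⊥-elim (<-irrefl (cong toℕ (f-inj (Fin.punchOut-injective (miss ∘ (i ,_) ∘ sym) (miss ∘ (j ,_) ∘ sym) eq))) i<j)

opposite-injective : ∀ {n} → Injective _≡_ _≡_ (opposite {n})
opposite-injective {x = x} {y} eq =
  trans (sym (Fin.opposite-involutive x)) (trans (cong opposite eq) (Fin.opposite-involutive y))

ascending⇒gap : ∀ {n} (w : ℕ → ℕ) → (∀ j → suc j < n → w j < w (suc j)) →
  ∀ i d → i + d < n → w i + d ≤ w (i + d)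
ascending⇒gap w ascending i zero _ = ≤-reflexive (trans (+-identityʳ (w i)) (cong w (sym (+-identityʳ i))))
ascending⇒gap {n} w ascending i (suc d) i+1+d<n = begin
  w i + suc d     ≡⟨ +-suc (w i) d ⟩
  suc (w i + d)   ≤⟨ s≤s (ascending⇒gap w ascending i d (<-trans (n<1+n (i + d)) 1+i+d<n)) ⟩
  suc (w (i + d)) ≤⟨ ascending (i + d) 1+i+d<n ⟩
  w (suc (i + d)) ≡⟨ cong w (+-suc i d) ⟨
  w (i + suc d)   ∎
  where
  open ≤-Reasoning
  1+i+d<n : suc (i + d) < n
  1+i+d<n = subst (_< n) (+-suc i d) i+1+d<n

ascending⇒identity : ∀ {n} (w : ℕ → ℕ) → (∀ j → j < n → w j < n) → (∀ j → suc j < n → w j < w (suc j)) →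
  ∀ j → j < n → w j ≡ j
ascending⇒identity {n} w bounded ascending j j<n = ≤-antisym upper lower
  where
  lower : j ≤ w j
  lower = ≤-trans (m≤n+m j (w 0)) (ascending⇒gap w ascending 0 j j<n)
  d : ℕ
  d = n ∸ suc j
  1+j+d≡n : suc j + d ≡ n
  1+j+d≡n = m+[n∸m]≡n j<n
  j+d<n : j + d < n
  j+d<n = ≤-reflexive 1+j+d≡n
  upper : w j ≤ j
  upper = s≤s⁻¹ (+-cancelʳ-< d (w j) (suc j) (begin-strict
    w j + d   ≤⟨ ascending⇒gap w ascending j d j+d<n ⟩
    w (j + d) <⟨ bounded (j + d) j+d<n ⟩
    n         ≡⟨ 1+j+d≡n ⟨
    suc j + d ∎))
    where open ≤-Reasoning

⟨_,_,_⟩ : {A : Set} → A → A → A → Fin 3 → A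
⟨ a , b , c ⟩ 0F = a
⟨ a , b , c ⟩ 1F = b
⟨ a , b , c ⟩ 2F = c

pointwise₃ : {A : Set} {f g : Fin 3 → A} → f 0F ≡ g 0F → f 1F ≡ g 1F → f 2F ≡ g 2F → f ≗ g
pointwise₃ e₀ e₁ e₂ 0F = e₀
pointwise₃ e₀ e₁ e₂ 1F = e₁
pointwise₃ e₀ e₁ e₂ 2F = e₂

ascending₃ : (h : Fin 3 → ℕ) → h 0F < h 1F → h 1F < h 2F → ∀ {i j} → toℕ i < toℕ j → h i < h j
ascending₃ h l₀₁ l₁₂ {0F} {1F} _ = l₀₁
ascending₃ h l₀₁ l₁₂ {0F} {2F} _ = <-trans l₀₁ l₁₂
ascending₃ h l₀₁ l₁₂ {1F} {2F} _ = l₁₂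
ascending₃ h l₀₁ l₁₂ {1F} {1F} (s≤s ())
ascending₃ h l₀₁ l₁₂ {2F} {1F} (s≤s ())
ascending₃ h l₀₁ l₁₂ {2F} {2F} (s≤s (s≤s ()))

SameOrder-sorted₃ : (ρ : Fin 3 → Fin 3) (h : Fin 3 → ℕ) → h 0F < h 1F → h 1F < h 2F → SameOrder (toℕ ∘ ρ) (h ∘ ρ)
SameOrder-sorted₃ ρ h l₀₁ l₁₂ = SameOrder-∘ ρ (increasing⇒SameOrder h (ascending₃ h l₀₁ l₁₂))

nonVinculum : Fin 2 → Fin 3
nonVinculum 0F = 2F
nonVinculum 1F = 0F

-- The positions of a pattern in cyclic order, starting with the vinculum.
fromVinculum : Fin 2 → Fin 3 → Fin 3
fromVinculum v = ⟨ inject₁ v , fsuc v , nonVinculum v ⟩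

fromVinculum-distinct : ∀ v → fromVinculum v 0F ≢ fromVinculum v 1F
                            × fromVinculum v 1F ≢ fromVinculum v 2F
                            × fromVinculum v 0F ≢ fromVinculum v 2F
fromVinculum-distinct 0F = (λ ()) , (λ ()) , (λ ())
fromVinculum-distinct 1F = (λ ()) , (λ ()) , (λ ())

module _ {m : ℕ} where

  N : ℕ
  N = suc m

  %-absorbˡ : ∀ a b → (a % N + b) % N ≡ (a + b) % N
  %-absorbˡ a b = begin
    (a % N + b) % N         ≡⟨ %-distribˡ-+ (a % N) b N ⟩
    (a % N % N + b % N) % N ≡⟨ cong (λ t → (t + b % N) % N) (m%n%n≡m%n a N) ⟩
    (a % N + b % N) % N     ≡⟨ %-distribˡ-+ a b N ⟨
    (a + b) % N             ∎
    where open ≡-Reasoning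

  %-absorbʳ : ∀ a b → (a + b % N) % N ≡ (a + b) % N
  %-absorbʳ a b = begin
    (a + b % N) % N ≡⟨ cong (_% N) (+-comm a (b % N)) ⟩
    (b % N + a) % N ≡⟨ %-absorbˡ b a ⟩
    (b + a) % N     ≡⟨ cong (_% N) (+-comm b a) ⟩
    (a + b) % N     ∎
    where open ≡-Reasoning

  -- k ⊕ j is the position j steps after k; the sum is written j + k so that
  -- rot k σ i reduces to σ (k ⊕ toℕ i).
  _⊕_ : Fin N → ℕ → Fin N
  k ⊕ j = fromℕ< (m%n<n (j + toℕ k) N)

  toℕ-⊕ : ∀ k j → toℕ (k ⊕ j) ≡ (j + toℕ k) % N
  toℕ-⊕ k j = Fin.toℕ-fromℕ< (m%n<n (j + toℕ k) N)

  ⊕-identityʳ : ∀ k → k ⊕ 0 ≡ k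
  ⊕-identityʳ k = Fin.toℕ-injective (trans (toℕ-⊕ k 0) (m<n⇒m%n≡m (Fin.toℕ<n k)))

  ⊕-assoc : ∀ k a b → (k ⊕ a) ⊕ b ≡ k ⊕ (b + a)
  ⊕-assoc k a b = Fin.toℕ-injective (begin
    toℕ ((k ⊕ a) ⊕ b)        ≡⟨ toℕ-⊕ (k ⊕ a) b ⟩
    (b + toℕ (k ⊕ a)) % N    ≡⟨ cong (λ t → (b + t) % N) (toℕ-⊕ k a) ⟩
    (b + (a + toℕ k) % N) % N ≡⟨ %-absorbʳ b (a + toℕ k) ⟩
    (b + (a + toℕ k)) % N    ≡⟨ cong (_% N) (+-assoc b a (toℕ k)) ⟨
    (b + a + toℕ k) % N      ≡⟨ toℕ-⊕ k (b + a) ⟨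
    toℕ (k ⊕ (b + a))        ∎)
    where open ≡-Reasoning

  ⊕-period : ∀ k → k ⊕ N ≡ k
  ⊕-period k = Fin.toℕ-injective (begin
    toℕ (k ⊕ N)     ≡⟨ toℕ-⊕ k N ⟩
    (N + toℕ k) % N ≡⟨ cong (_% N) (+-comm N (toℕ k)) ⟩
    (toℕ k + N) % N ≡⟨ [m+n]%n≡m%n (toℕ k) N ⟩
    toℕ k % N       ≡⟨ m<n⇒m%n≡m (Fin.toℕ<n k) ⟩
    toℕ k           ∎)
    where open ≡-Reasoning

  toℕ-⊕1 : ∀ x → toℕ (x ⊕ 1) ≡ suc (toℕ x) ⊎ (toℕ x ≡ m × toℕ (x ⊕ 1) ≡ 0)
  toℕ-⊕1 x with m≤n⇒m<n∨m≡n (s≤s⁻¹ (Fin.toℕ<n x))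
  ... | inj₁ x<m = inj₁ (trans (toℕ-⊕ x 1) (m≤n⇒m%n≡m x<m))
  ... | inj₂ x≡m = inj₂ (x≡m , trans (toℕ-⊕ x 1) (trans (cong (λ t → suc t % N) x≡m) (n%n≡0 N)))

  descent⇒wraps : ∀ x → toℕ (x ⊕ 1) < toℕ x → toℕ x ≡ m × toℕ (x ⊕ 1) ≡ 0
  descent⇒wraps x descent with toℕ-⊕1 x
  ... | inj₁ x⊕1≡1+x = ⊥-elim (<-asym descent (subst (toℕ x <_) (sym x⊕1≡1+x) (n<1+n (toℕ x))))
  ... | inj₂ wraps   = wraps

  ascent⇒successor : ∀ x → toℕ x < toℕ (x ⊕ 1) → toℕ (x ⊕ 1) ≡ suc (toℕ x)
  ascent⇒successor x ascent with toℕ-⊕1 x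
  ... | inj₁ x⊕1≡1+x    = x⊕1≡1+x
  ... | inj₂ (_ , x⊕1≡0) = ⊥-elim (n≮0 (subst (toℕ x <_) x⊕1≡0 ascent))

  neg : Fin N → Fin N
  neg p = fromℕ< (m%n<n (N ∸ toℕ p) N)

  +-neg-% : ∀ p a → (a + toℕ p + toℕ (neg p)) % N ≡ a % N
  +-neg-% p a = begin
    (a + toℕ p + toℕ (neg p)) % N     ≡⟨ cong (λ t → (a + toℕ p + t) % N) (Fin.toℕ-fromℕ< (m%n<n (N ∸ toℕ p) N)) ⟩
    (a + toℕ p + (N ∸ toℕ p) % N) % N ≡⟨ %-absorbʳ (a + toℕ p) (N ∸ toℕ p) ⟩
    (a + toℕ p + (N ∸ toℕ p)) % N     ≡⟨ cong (_% N) (+-assoc a (toℕ p) (N ∸ toℕ p)) ⟩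
    (a + (toℕ p + (N ∸ toℕ p))) % N   ≡⟨ cong (λ t → (a + t) % N) (m+[n∸m]≡n (<⇒≤ (Fin.toℕ<n p))) ⟩
    (a + N) % N                       ≡⟨ [m+n]%n≡m%n a N ⟩
    a % N                             ∎
    where open ≡-Reasoning

  _⊖_ : Fin N → Fin N → ℕ
  i ⊖ p = toℕ (neg p ⊕ toℕ i)

  ⊕-⊖ : ∀ p i → p ⊕ (i ⊖ p) ≡ i
  ⊕-⊖ p i = Fin.toℕ-injective (begin
    toℕ (p ⊕ (i ⊖ p))                     ≡⟨ toℕ-⊕ p (i ⊖ p) ⟩
    (i ⊖ p + toℕ p) % N                   ≡⟨ cong (λ t → (t + toℕ p) % N) (toℕ-⊕ (neg p) (toℕ i)) ⟩
    ((toℕ i + toℕ (neg p)) % N + toℕ p) % N ≡⟨ %-absorbˡ (toℕ i + toℕ (neg p)) (toℕ p) ⟩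
    (toℕ i + toℕ (neg p) + toℕ p) % N     ≡⟨ cong (_% N) (xy∙z≈xz∙y (toℕ i) (toℕ (neg p)) (toℕ p)) ⟩
    (toℕ i + toℕ p + toℕ (neg p)) % N     ≡⟨ +-neg-% p (toℕ i) ⟩
    toℕ i % N                             ≡⟨ m<n⇒m%n≡m (Fin.toℕ<n i) ⟩
    toℕ i                                 ∎)
    where open ≡-Reasoning

  ⊖-⊕ : ∀ p {a} → a < N → (p ⊕ a) ⊖ p ≡ a
  ⊖-⊕ p {a} a<N = begin
    (p ⊕ a) ⊖ p                                 ≡⟨ toℕ-⊕ (neg p) (toℕ (p ⊕ a)) ⟩
    (toℕ (p ⊕ a) + toℕ (neg p)) % N             ≡⟨ cong (λ t → (t + toℕ (neg p)) % N) (toℕ-⊕ p a) ⟩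
    ((a + toℕ p) % N + toℕ (neg p)) % N         ≡⟨ %-absorbˡ (a + toℕ p) (toℕ (neg p)) ⟩
    (a + toℕ p + toℕ (neg p)) % N               ≡⟨ +-neg-% p a ⟩
    a % N                                       ≡⟨ m<n⇒m%n≡m a<N ⟩
    a                                           ∎
    where open ≡-Reasoning

  ⊕-injective : ∀ p {a b} → a < N → b < N → p ⊕ a ≡ p ⊕ b → a ≡ b
  ⊕-injective p {a} {b} a<N b<N eq = trans (sym (⊖-⊕ p a<N)) (trans (cong (_⊖ p) eq) (⊖-⊕ p b<N))

  ⊖<N : ∀ i p → i ⊖ p < N
  ⊖<N i p = Fin.toℕ<n (neg p ⊕ toℕ i)

  HasTriple : (Fin 3 → Fin 3) → (Fin N → Fin N) → Set
  HasTriple ρ τ = ∃₂ λ x c → SameOrder (toℕ ∘ ρ) (toℕ ∘ τ ∘ ⟨ x , x ⊕ 1 , c ⟩)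

  HasTriple-resp : ∀ {ρ ρ′ τ τ′} → ρ ≗ ρ′ → τ ≗ τ′ → HasTriple ρ τ → HasTriple ρ′ τ′
  HasTriple-resp ρ≗ τ≗ (x , c , same) =
    x , c , SameOrder-resp (cong toℕ ∘ ρ≗) (cong toℕ ∘ τ≗ ∘ ⟨ x , x ⊕ 1 , c ⟩) same

  HasTriple-opposite : ∀ {ρ τ} → HasTriple ρ τ → HasTriple (opposite ∘ ρ) (opposite ∘ τ)
  HasTriple-opposite (x , c , same) = x , c , SameOrder-opposite same

  Occurs⇒HasTriple : ∀ {π v k τ} → Occurs (vpat π v) (rot k τ) → HasTriple (proj₁ π ∘ fromVinculum v) τ
  Occurs⇒HasTriple {π} {v} {k} {τ} (pos , _ , _ , same , adjacent) =
    x , c , SameOrder-resp (λ _ → refl) values (SameOrder-∘ (fromVinculum v) same)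
    where
    x c : Fin N
    x = k ⊕ toℕ (pos (inject₁ v))
    c = k ⊕ toℕ (pos (nonVinculum v))
    values : toℕ ∘ rot k τ ∘ pos ∘ fromVinculum v ≗ toℕ ∘ τ ∘ ⟨ x , x ⊕ 1 , c ⟩
    values = pointwise₃ refl (cong (toℕ ∘ τ) (trans (cong (k ⊕_) (sym adjacent)) (sym (⊕-assoc k _ 1)))) refl

  offsets⇒Occurs : ∀ {π v τ} (k : Fin N) (o : Fin 3 → ℕ) → o 0F < o 1F → o 1F < o 2F → o 2F < N →
    suc (o (inject₁ v)) ≡ o (fsuc v) → SameOrder (toℕ ∘ proj₁ π) (toℕ ∘ τ ∘ (k ⊕_) ∘ o) →
    Occurs (vpat π v) (rot k τ)
  offsets⇒Occurs {π} {v} {τ} k o o₀<o₁ o₁<o₂ o₂<N adjacent same =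
    pos , ordered o₀<o₁ , ordered o₁<o₂ , SameOrder-resp (λ _ → refl) values same ,
    trans (cong suc (toℕ-pos (inject₁ v))) (trans adjacent (sym (toℕ-pos (fsuc v))))
    where
    o<N : ∀ a → o a < N
    o<N 0F = <-trans o₀<o₁ (<-trans o₁<o₂ o₂<N)
    o<N 1F = <-trans o₁<o₂ o₂<N
    o<N 2F = o₂<N
    pos : Fin 3 → Fin N
    pos a = fromℕ< (o<N a)
    toℕ-pos : ∀ a → toℕ (pos a) ≡ o a
    toℕ-pos a = Fin.toℕ-fromℕ< (o<N a)
    ordered : ∀ {a b} → o a < o b → toℕ (pos a) < toℕ (pos b)
    ordered {a} {b} = subst₂ _<_ (sym (toℕ-pos a)) (sym (toℕ-pos b))
    values : toℕ ∘ τ ∘ (k ⊕_) ∘ o ≗ toℕ ∘ rot k τ ∘ pos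
    values a = cong (λ i → toℕ (τ (k ⊕ i))) (sym (toℕ-pos a))

  third-apart : ∀ (π : Perm 3) v {τ : Fin N → Fin N} {x c} →
    SameOrder (toℕ ∘ proj₁ π ∘ fromVinculum v) (toℕ ∘ τ ∘ ⟨ x , x ⊕ 1 , c ⟩) → c ≢ x × c ≢ x ⊕ 1
  third-apart (π , π-inj) v {τ} same with fromVinculum-distinct v
  ... | _ , v₁≢v₂ , v₀≢v₂ =
      (λ c≡x → v₀≢v₂ (π-inj (sym (Fin.toℕ-injective (SameOrder-reflects-≡ same {2F} {0F} (cong (toℕ ∘ τ) c≡x))))))
    , (λ c≡x⊕1 → v₁≢v₂ (π-inj (sym (Fin.toℕ-injective (SameOrder-reflects-≡ same {2F} {1F} (cong (toℕ ∘ τ) c≡x⊕1))))))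

  HasTriple⇒CycContains : ∀ (π : Perm 3) v (τ : Perm N) → HasTriple (proj₁ π ∘ fromVinculum v) (proj₁ τ) →
    CycContains τ (vpat π v)
  HasTriple⇒CycContains (π , π-inj) 0F (τ , _) (x , c , same) =
    x , offsets⇒Occurs {π = π , π-inj} {0F} {τ} x ⟨ 0 , 1 , d ⟩ z<s 1<d (⊖<N c x) refl
          (SameOrder-resp unrotated values same)
    where
    unrotated : toℕ ∘ π ∘ fromVinculum 0F ≗ toℕ ∘ π
    unrotated = pointwise₃ refl refl refl
    apart : c ≢ x × c ≢ x ⊕ 1
    apart = third-apart (π , π-inj) 0F {τ} same
    d : ℕ
    d = c ⊖ x
    x⊕d≡c : x ⊕ d ≡ c
    x⊕d≡c = ⊕-⊖ x c
    1<d : 1 < d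
    1<d = ≤∧≢⇒< (n≢0⇒n>0 λ d≡0 → proj₁ apart (trans (sym x⊕d≡c) (trans (cong (x ⊕_) d≡0) (⊕-identityʳ x))))
                (λ 1≡d → proj₂ apart (trans (sym x⊕d≡c) (cong (x ⊕_) (sym 1≡d))))
    values : toℕ ∘ τ ∘ ⟨ x , x ⊕ 1 , c ⟩ ≗ toℕ ∘ τ ∘ (x ⊕_) ∘ ⟨ 0 , 1 , d ⟩
    values = pointwise₃ (cong (toℕ ∘ τ) (sym (⊕-identityʳ x))) refl (cong (toℕ ∘ τ) (sym x⊕d≡c))
  HasTriple⇒CycContains (π , π-inj) 1F (τ , _) (x , c , same) =
    c , offsets⇒Occurs {π = π , π-inj} {1F} {τ} c ⟨ 0 , e , suc e ⟩ (n≢0⇒n>0 e≢0) (n<1+n e) 1+e<N refl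
          (SameOrder-resp unrotated values (SameOrder-∘ ⟨ 2F , 0F , 1F ⟩ same))
    where
    unrotated : toℕ ∘ π ∘ fromVinculum 1F ∘ ⟨ 2F , 0F , 1F ⟩ ≗ toℕ ∘ π
    unrotated = pointwise₃ refl refl refl
    apart : c ≢ x × c ≢ x ⊕ 1
    apart = third-apart (π , π-inj) 1F {τ} same
    e : ℕ
    e = x ⊖ c
    c⊕e≡x : c ⊕ e ≡ x
    c⊕e≡x = ⊕-⊖ c x
    c⊕1+e≡x⊕1 : c ⊕ suc e ≡ x ⊕ 1
    c⊕1+e≡x⊕1 = trans (sym (⊕-assoc c e 1)) (cong (_⊕ 1) c⊕e≡x)
    e≢0 : e ≢ 0
    e≢0 e≡0 = proj₁ apart (trans (sym (⊕-identityʳ c)) (trans (cong (c ⊕_) (sym e≡0)) c⊕e≡x))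
    1+e<N : suc e < N
    1+e<N = s≤s (≤∧≢⇒< (s≤s⁻¹ (⊖<N x c))
      λ e≡m → proj₂ apart (trans (sym (⊕-period c)) (trans (cong (c ⊕_ ∘ suc) (sym e≡m)) c⊕1+e≡x⊕1)))
    values : toℕ ∘ τ ∘ ⟨ x , x ⊕ 1 , c ⟩ ∘ ⟨ 2F , 0F , 1F ⟩ ≗ toℕ ∘ τ ∘ (c ⊕_) ∘ ⟨ 0 , e , suc e ⟩
    values = pointwise₃ (cong (toℕ ∘ τ) (sym (⊕-identityʳ c))) (cong (toℕ ∘ τ) (sym c⊕e≡x))
                        (cong (toℕ ∘ τ) (sym c⊕1+e≡x⊕1))

  idPerm : Perm N
  idPerm = (λ i → i) , (λ eq → eq)

  record UniqueAvoider (ρ : Fin 3 → Fin 3) (σ : Perm N) : Set where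
    field
      avoids : ¬ HasTriple ρ (proj₁ σ)
      unique : (τ : Perm N) → ¬ HasTriple ρ (proj₁ τ) → SameCyc σ τ

  open UniqueAvoider public

  reading : (Fin N → Fin N) → Fin N → ℕ → ℕ
  reading τ p j = toℕ (τ (p ⊕ j))

  reading-injective : ∀ {τ} → Injective _≡_ _≡_ τ → ∀ p {i j} → i < N → j < N → reading τ p i ≡ reading τ p j → i ≡ j
  reading-injective τ-inj p i<N j<N eq = ⊕-injective p i<N j<N (τ-inj (Fin.toℕ-injective eq))

  HasTriple-reading : ∀ {ρ} τ p j c → SameOrder (toℕ ∘ ρ) ⟨ reading τ p j , reading τ p (suc j) , toℕ (τ c) ⟩ →
    HasTriple ρ τ
  HasTriple-reading τ p j c same =
    p ⊕ j , c , SameOrder-resp (λ _ → refl) (pointwise₃ refl (cong (toℕ ∘ τ) (sym (⊕-assoc p j 1))) refl) same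

  reading-identity⇒SameCyc : ∀ (τ : Perm N) p → (∀ j → j < N → reading (proj₁ τ) p j ≡ j) → SameCyc idPerm τ
  reading-identity⇒SameCyc (τ , _) p is-identity = neg p , λ i → Fin.toℕ-injective (begin
    toℕ (τ i)           ≡⟨ cong (toℕ ∘ τ) (⊕-⊖ p i) ⟨
    reading τ p (i ⊖ p) ≡⟨ is-identity (i ⊖ p) (⊖<N i p) ⟩
    i ⊖ p               ∎)
    where open ≡-Reasoning

  no-descent⇒SameCyc : ∀ (τ : Perm N) p → (∀ j → suc j < N → ¬ reading (proj₁ τ) p (suc j) < reading (proj₁ τ) p j) →
    SameCyc idPerm τ
  no-descent⇒SameCyc (τ , τ-inj) p no-descent =
    reading-identity⇒SameCyc (τ , τ-inj) p (ascending⇒identity (reading τ p) (λ j _ → Fin.toℕ<n (τ (p ⊕ j))) ascent)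
    where
    ascent : ∀ j → suc j < N → reading τ p j < reading τ p (suc j)
    ascent j 1+j<N with <-cmp (reading τ p j) (reading τ p (suc j))
    ... | tri< lt _ _ = lt
    ... | tri≈ _ eq _ = ⊥-elim (1+n≢n (sym (reading-injective τ-inj p (<-trans (n<1+n j) 1+j<N) 1+j<N eq)))
    ... | tri> _ _ gt = ⊥-elim (no-descent j 1+j<N gt)

  -- [ab]c is the pattern [\overline{ab}c] read from its vinculum, with values counted from 0.
  [21]3 [32]1 [13]2 : Fin 3 → Fin 3
  [21]3 = ⟨ 1F , 0F , 2F ⟩
  [32]1 = ⟨ 2F , 1F , 0F ⟩
  [13]2 = ⟨ 0F , 2F , 1F ⟩

  SameOrder-[21]3 : ∀ {a b c} → b < a → a < c → SameOrder (toℕ ∘ [21]3) ⟨ a , b , c ⟩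
  SameOrder-[21]3 {a} {b} {c} b<a a<c =
    SameOrder-resp (λ _ → refl) (pointwise₃ refl refl refl) (SameOrder-sorted₃ [21]3 ⟨ b , a , c ⟩ b<a a<c)

  SameOrder-[32]1 : ∀ {a b c} → c < b → b < a → SameOrder (toℕ ∘ [32]1) ⟨ a , b , c ⟩
  SameOrder-[32]1 {a} {b} {c} c<b b<a =
    SameOrder-resp (λ _ → refl) (pointwise₃ refl refl refl) (SameOrder-sorted₃ [32]1 ⟨ c , b , a ⟩ c<b b<a)

  SameOrder-[13]2 : ∀ {a b c} → a < c → c < b → SameOrder (toℕ ∘ [13]2) ⟨ a , b , c ⟩
  SameOrder-[13]2 {a} {b} {c} a<c c<b =
    SameOrder-resp (λ _ → refl) (pointwise₃ refl refl refl) (SameOrder-sorted₃ [13]2 ⟨ a , c , b ⟩ a<c c<b)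

  [21]3-unique : UniqueAvoider [21]3 idPerm
  [21]3-unique .avoids (x , c , same) = <⇒≱ (proj₁ (same 0F 2F) (s<s z<s))
      (subst (toℕ c ≤_) (sym (proj₁ (descent⇒wraps x (proj₁ (same 1F 0F) z<s)))) (s≤s⁻¹ (Fin.toℕ<n c)))
  [21]3-unique .unique (τ , τ-inj) τ-avoids = no-descent⇒SameCyc (τ , τ-inj) p descent-free
    where
    r : Fin N
    r = proj₁ (injective⇒surjective τ-inj (fromℕ m))
    p : Fin N
    p = r ⊕ 1
    τr≡m : toℕ (τ r) ≡ m
    τr≡m = trans (cong toℕ (proj₂ (injective⇒surjective τ-inj (fromℕ m)))) (Fin.toℕ-fromℕ m)
    maximum-last : reading τ p m ≡ m
    maximum-last = trans (cong (toℕ ∘ τ) (trans (⊕-assoc r 1 m) (trans (cong (r ⊕_) (+-comm m 1)) (⊕-period r)))) τr≡m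
    descent-free : ∀ j → suc j < N → ¬ reading τ p (suc j) < reading τ p j
    descent-free j 1+j<N descent = τ-avoids (HasTriple-reading τ p j r (SameOrder-[21]3 descent below-maximum))
      where
      not-maximum : reading τ p j ≢ m
      not-maximum eq = <⇒≢ (s≤s⁻¹ 1+j<N)
        (reading-injective τ-inj p (<-trans (n<1+n j) 1+j<N) (n<1+n m) (trans eq (sym maximum-last)))
      below-maximum : reading τ p j < toℕ (τ r)
      below-maximum = subst (reading τ p j <_) (sym τr≡m) (≤∧≢⇒< (s≤s⁻¹ (Fin.toℕ<n (τ (p ⊕ j)))) not-maximum)

  [32]1-unique : UniqueAvoider [32]1 idPerm
  [32]1-unique .avoids (x , c , same) =
      n≮0 (subst (toℕ c <_) (proj₂ (descent⇒wraps x (proj₁ (same 1F 0F) (s<s z<s)))) (proj₁ (same 2F 1F) z<s))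
  [32]1-unique .unique (τ , τ-inj) τ-avoids = no-descent⇒SameCyc (τ , τ-inj) r descent-free
    where
    r : Fin N
    r = proj₁ (injective⇒surjective τ-inj 0F)
    τr≡0 : toℕ (τ r) ≡ 0
    τr≡0 = cong toℕ (proj₂ (injective⇒surjective τ-inj 0F))
    minimum-first : reading τ r 0 ≡ 0
    minimum-first = trans (cong (toℕ ∘ τ) (⊕-identityʳ r)) τr≡0
    descent-free : ∀ j → suc j < N → ¬ reading τ r (suc j) < reading τ r j
    descent-free j 1+j<N descent = τ-avoids (HasTriple-reading τ r j r (SameOrder-[32]1 above-minimum descent))
      where
      not-minimum : reading τ r (suc j) ≢ 0
      not-minimum eq = 1+n≢0 (reading-injective τ-inj r 1+j<N z<s (trans eq (sym minimum-first)))
      above-minimum : toℕ (τ r) < reading τ r (suc j)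
      above-minimum = subst (_< reading τ r (suc j)) (sym τr≡0) (n≢0⇒n>0 not-minimum)

  [13]2-unique : UniqueAvoider [13]2 idPerm
  [13]2-unique .avoids (x , c , same) = <⇒≱ (proj₁ (same 0F 2F) z<s)
      (s≤s⁻¹ (subst (toℕ c <_) (ascent⇒successor x (proj₁ (same 0F 1F) z<s)) (proj₁ (same 2F 1F) (s<s z<s))))
  [13]2-unique .unique (τ , τ-inj) τ-avoids = reading-identity⇒SameCyc (τ , τ-inj) r (λ j j<N → prefix j j<N ≤-refl)
    where
    r : Fin N
    r = proj₁ (injective⇒surjective τ-inj 0F)
    minimum-first : reading τ r 0 ≡ 0
    minimum-first = trans (cong (toℕ ∘ τ) (⊕-identityʳ r)) (cong toℕ (proj₂ (injective⇒surjective τ-inj 0F)))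
    next : ∀ j → suc j < N → (∀ {i} → i ≤ j → reading τ r i ≡ i) → reading τ r (suc j) ≡ suc j
    next j 1+j<N prefix-j = ≤-antisym (≮⇒≥ no-gap) above-prefix
      where
      w : ℕ
      w = reading τ r (suc j)
      above-prefix : j < w
      above-prefix = ≰⇒> λ w≤j → <⇒≱ (n<1+n j) (subst (_≤ j)
        (reading-injective τ-inj r (Fin.toℕ<n (τ (r ⊕ suc j))) 1+j<N (prefix-j w≤j)) w≤j)
      c : Fin N
      c = proj₁ (injective⇒surjective τ-inj (fromℕ< 1+j<N))
      τc≡1+j : toℕ (τ c) ≡ suc j
      τc≡1+j = trans (cong toℕ (proj₂ (injective⇒surjective τ-inj (fromℕ< 1+j<N)))) (Fin.toℕ-fromℕ< 1+j<N)
      no-gap : ¬ suc j < w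
      no-gap 1+j<w = τ-avoids (HasTriple-reading τ r j c (SameOrder-[13]2
        (subst₂ _<_ (sym (prefix-j ≤-refl)) (sym τc≡1+j) (n<1+n j)) (subst (_< w) (sym τc≡1+j) 1+j<w)))
    prefix : ∀ j → j < N → ∀ {i} → i ≤ j → reading τ r i ≡ i
    prefix zero    _     z≤n = minimum-first
    prefix (suc j) 1+j<N i≤1+j with m≤n⇒m<n∨m≡n i≤1+j
    ... | inj₁ i<1+j = prefix j (<-trans (n<1+n j) 1+j<N) (s≤s⁻¹ i<1+j)
    ... | inj₂ refl  = next j 1+j<N (prefix j (<-trans (n<1+n j) 1+j<N))

  complement : Perm N → Perm N
  complement (σ , σ-inj) = opposite ∘ σ , σ-inj ∘ opposite-injective

  SameCyc-complement : ∀ σ τ → SameCyc σ (complement τ) → SameCyc (complement σ) τ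
  SameCyc-complement σ (τ , _) (k , τ≡) = k , λ i → trans (sym (Fin.opposite-involutive (τ i))) (cong opposite (τ≡ i))

  UniqueAvoider-resp : ∀ {ρ ρ′ σ} → ρ ≗ ρ′ → UniqueAvoider ρ σ → UniqueAvoider ρ′ σ
  UniqueAvoider-resp {σ = σ} ρ≗ρ′ U .avoids = U .avoids ∘ HasTriple-resp {τ = proj₁ σ} (sym ∘ ρ≗ρ′) (λ _ → refl)
  UniqueAvoider-resp ρ≗ρ′ U .unique τ τ-avoids = U .unique τ (τ-avoids ∘ HasTriple-resp {τ = proj₁ τ} ρ≗ρ′ (λ _ → refl))

  UniqueAvoider-complement : ∀ {ρ σ} → UniqueAvoider ρ σ → UniqueAvoider (opposite ∘ ρ) (complement σ)
  UniqueAvoider-complement {ρ} {σ} U .avoids =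
    U .avoids ∘ HasTriple-resp (Fin.opposite-involutive ∘ ρ) (Fin.opposite-involutive ∘ proj₁ σ)
                ∘ HasTriple-opposite {opposite ∘ ρ} {opposite ∘ proj₁ σ}
  UniqueAvoider-complement {ρ} {σ} U .unique τ τ-avoids = SameCyc-complement σ τ (U .unique (complement τ)
    (τ-avoids ∘ HasTriple-resp (λ _ → refl) (Fin.opposite-involutive ∘ proj₁ τ)
              ∘ HasTriple-opposite {ρ} {opposite ∘ proj₁ τ}))

  uniqueAvoider₃ : ∀ a b c → a ≢ b → b ≢ c → a ≢ c → Σ (Perm N) (UniqueAvoider ⟨ a , b , c ⟩)
  uniqueAvoider₃ 1F 0F 2F _ _ _ = idPerm , [21]3-unique
  uniqueAvoider₃ 2F 1F 0F _ _ _ = idPerm , [32]1-unique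
  uniqueAvoider₃ 0F 2F 1F _ _ _ = idPerm , [13]2-unique
  uniqueAvoider₃ 1F 2F 0F _ _ _ =
    complement idPerm , UniqueAvoider-resp (pointwise₃ refl refl refl) (UniqueAvoider-complement [21]3-unique)
  uniqueAvoider₃ 0F 1F 2F _ _ _ =
    complement idPerm , UniqueAvoider-resp (pointwise₃ refl refl refl) (UniqueAvoider-complement [32]1-unique)
  uniqueAvoider₃ 2F 0F 1F _ _ _ =
    complement idPerm , UniqueAvoider-resp (pointwise₃ refl refl refl) (UniqueAvoider-complement [13]2-unique)
  uniqueAvoider₃ 0F 0F _  a≢b _   _   = ⊥-elim (a≢b refl)
  uniqueAvoider₃ 1F 1F _  a≢b _   _   = ⊥-elim (a≢b refl)
  uniqueAvoider₃ 2F 2F _  a≢b _   _   = ⊥-elim (a≢b refl)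
  uniqueAvoider₃ 0F 1F 1F _   b≢c _   = ⊥-elim (b≢c refl)
  uniqueAvoider₃ 0F 2F 2F _   b≢c _   = ⊥-elim (b≢c refl)
  uniqueAvoider₃ 1F 0F 0F _   b≢c _   = ⊥-elim (b≢c refl)
  uniqueAvoider₃ 1F 2F 2F _   b≢c _   = ⊥-elim (b≢c refl)
  uniqueAvoider₃ 2F 0F 0F _   b≢c _   = ⊥-elim (b≢c refl)
  uniqueAvoider₃ 2F 1F 1F _   b≢c _   = ⊥-elim (b≢c refl)
  uniqueAvoider₃ 0F 1F 0F _   _   a≢c = ⊥-elim (a≢c refl)
  uniqueAvoider₃ 0F 2F 0F _   _   a≢c = ⊥-elim (a≢c refl)
  uniqueAvoider₃ 1F 0F 1F _   _   a≢c = ⊥-elim (a≢c refl)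
  uniqueAvoider₃ 1F 2F 1F _   _   a≢c = ⊥-elim (a≢c refl)
  uniqueAvoider₃ 2F 0F 2F _   _   a≢c = ⊥-elim (a≢c refl)
  uniqueAvoider₃ 2F 1F 2F _   _   a≢c = ⊥-elim (a≢c refl)

  uniqueAvoider : ∀ (π : Perm 3) v → Σ (Perm N) (UniqueAvoider (proj₁ π ∘ fromVinculum v))
  uniqueAvoider (π , π-inj) v with fromVinculum-distinct v
  ... | v₀≢v₁ , v₁≢v₂ , v₀≢v₂ = map₂ (UniqueAvoider-resp (pointwise₃ refl refl refl))
    (uniqueAvoider₃ (π (inject₁ v)) (π (fsuc v)) (π (nonVinculum v))
                    (v₀≢v₁ ∘ π-inj) (v₁≢v₂ ∘ π-inj) (v₀≢v₂ ∘ π-inj))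

  UniqueAvoider⇒uniqueCycAvoider : ∀ π v {σ} → UniqueAvoider (proj₁ π ∘ fromVinculum v) σ →
    CycAvoids σ (vpat π v) × ((τ : Perm N) → CycAvoids τ (vpat π v) → SameCyc σ τ)
  UniqueAvoider⇒uniqueCycAvoider π v {σ} U =
      (λ (k , occurs) → U .avoids (Occurs⇒HasTriple {π = π} {v} {k} {proj₁ σ} occurs))
    , λ τ τ-avoids → U .unique τ (τ-avoids ∘ HasTriple⇒CycContains π v τ)

theorem3p2 : (p : VPat3) (n : ℕ) → n ≥ 1 →
    Σ (Perm n) λ σ → CycAvoids σ p × ((τ : Perm n) → CycAvoids τ p → SameCyc σ τ)
theorem3p2 p zero ()
theorem3p2 (vpat π v) (suc m) _ = map₂ (UniqueAvoider⇒uniqueCycAvoider π v) (uniqueAvoider π v)
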